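{- Let $T$ be a tree with more than one vertex, and let $S\subseteq V(T)$ contain at least two vertices. Construct a graph $\mathscr{T}(T)$ as follows: take three disjoint copies $T_1,T_2,T_3$ of $T$; for each vertex $v\in S$, with copies $v_1\in T_1$, $v_2\in T_2$, $v_3\in T_3$, add the three edges $v_1v_2$, $v_2v_3$, $v_1v_3$ (forming a $3$-cycle). Then $\operatorname{gon}(\mathscr{T}(T))=3$.
   Context: Graphs are finite, connected, loopless. Divisors are integer combinations of vertices; $D\sim D'$ if $D-D'$ is in the image of the Laplacian ($\Delta_{v,v}=\mathrm{val}(v)$, $\Delta_{v,w}=-$number of edges between $v,w$). The rank $r(D)$ is $-1$ if no effective divisor is equivalent to $D$, and otherwise the largest $k$ such that for every effective divisor $F$ of degree $k$ some effective divisor is equivalent to $D-F$. $\operatorname{gon}(G)$ is the minimum degree of an effective divisor of rank $\ge1$. -}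

module Defs where

open import Data.Nat as ℕ using (ℕ; zero; suc)
open import Data.Integer using (ℤ; +_; _+_; _-_; _*_; -_; _≤_; 0ℤ)
open import Data.Fin using (Fin; zero; suc; _≟_; remQuot)
open import Data.Fin.Subset using (Subset)
open import Data.Bool using (Bool; true; false; if_then_else_; _∧_)
open import Data.Vec using (lookup)
open import Data.List using (List; []; _∷_; length; _∷ʳ_)
open import Data.List.Relation.Unary.Linked using (Linked)
open import Data.List.Relation.Unary.Unique.Propositional using (Unique)
open import Data.Product using (Σ; ∃; _×_; _,_)
open import Relation.Nullary using (¬_)
open import Data.Empty using (⊥)
open import Relation.Nullary.Decidable using (⌊_⌋)
open import Relation.Binary.PropositionalEquality using (_≡_)

SimpleAdj : ℕ → Set
SimpleAdj n = Fin n → Fin n → Bool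

Edge : ∀ {n} → SimpleAdj n → Fin n → Fin n → Set
Edge adj u v = adj u v ≡ true

IsSymmetric : ∀ {n} → SimpleAdj n → Set
IsSymmetric adj = ∀ u v → adj u v ≡ adj v u

IsLoopless : ∀ {n} → SimpleAdj n → Set
IsLoopless adj = ∀ v → adj v v ≡ false

data Walk {n} (adj : SimpleAdj n) : Fin n → Fin n → Set where
  here : ∀ {v} → Walk adj v v
  step : ∀ {u v w} → Edge adj u v → Walk adj v w → Walk adj u w

IsConnected : ∀ {n} → SimpleAdj n → Set
IsConnected adj = ∀ u v → Walk adj u v

-- a cycle: a list v₀ … v_k of k+1 ≥ 3 distinct vertices,
-- consecutive ones adjacent, and v_k adjacent to v₀
IsCycle : ∀ {n} → SimpleAdj n → List (Fin n) → Set
IsCycle adj [] = ⊥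
IsCycle adj (v ∷ vs) =
  (3 ℕ.≤ length (v ∷ vs)) × Unique (v ∷ vs) × Linked (Edge adj) ((v ∷ vs) ∷ʳ v)

IsAcyclic : ∀ {n} → SimpleAdj n → Set
IsAcyclic adj = ∀ cs → ¬ IsCycle adj cs

IsTree : ∀ {n} → SimpleAdj n → Set
IsTree adj = IsSymmetric adj × IsLoopless adj × IsConnected adj × IsAcyclic adj

EdgeCount : ℕ → Set
EdgeCount m = Fin m → Fin m → ℕ

∑ : ∀ {m} → (Fin m → ℤ) → ℤ
∑ {zero}  f = 0ℤ
∑ {suc m} f = f zero + ∑ (λ i → f (suc i))

Divisor : ℕ → Set
Divisor m = Fin m → ℤ

valence : ∀ {m} → EdgeCount m → Fin m → ℤ
valence e v = ∑ (λ w → + e v w)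

laplacian : ∀ {m} → EdgeCount m → Fin m → Fin m → ℤ
laplacian e v w = if ⌊ v ≟ w ⌋ then valence e v else - (+ e v w)

InLaplacianImage : ∀ {m} → EdgeCount m → Divisor m → Set
InLaplacianImage e D = ∃ λ (f : Fin _ → ℤ) → ∀ v → D v ≡ ∑ (λ w → laplacian e v w * f w)

LinEquiv : ∀ {m} → EdgeCount m → Divisor m → Divisor m → Set
LinEquiv e D D' = InLaplacianImage e (λ v → D v - D' v)

Effective : ∀ {m} → Divisor m → Set
Effective D = ∀ v → 0ℤ ≤ D v

deg : ∀ {m} → Divisor m → ℤ
deg = ∑

RankCondition : ∀ {m} → EdgeCount m → Divisor m → ℕ → Set
RankCondition e D k =
  ∀ (F : Divisor _) → Effective F → deg F ≡ + k →
  ∃ λ (E : Divisor _) → Effective E × LinEquiv e E (λ v → D v - F v)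

-- r(D) ≥ k  (r(D) = -1 iff the condition fails at k = 0)
RankAtLeast : ∀ {m} → EdgeCount m → Divisor m → ℕ → Set
RankAtLeast e D k = ∀ j → j ℕ.≤ k → RankCondition e D j

IsGonality : ∀ {m} → EdgeCount m → ℕ → Set
IsGonality e g =
  (∃ λ (D : Divisor _) → Effective D × deg D ≡ + g × RankAtLeast e D 1) ×
  (∀ (D : Divisor _) → Effective D → RankAtLeast e D 1 → + g ≤ deg D)

-- The construction 𝒯(T): vertex set Fin (3 * n) ≅ Fin 3 × Fin n (via remQuot),
-- (a , v) is the copy of v in T_a.

𝒯 : ∀ n → SimpleAdj n → Subset n → EdgeCount (3 ℕ.* n)
𝒯 n adj S i j with remQuot {3} n i | remQuot {3} n j
... | (a , v) | (b , w) =
  if ⌊ a ≟ b ⌋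
  then (if adj v w then 1 else 0)
  else (if ⌊ v ≟ w ⌋ ∧ lookup S v then 1 else 0)

module Submission where

-- For a vertex p of T, the fibre p₁ + p₂ + p₃ has degree 3 and rank ≥ 1:
-- across an edge x y of T, the indicator of the side of x in T - xy, pulled back to
-- 𝒯(T), is a potential whose Laplacian is fibre x - fibre y (triangle edges join
-- vertices with equal values), so all fibres are linearly equivalent and every
-- chip can be absorbed by the fibre through it.
--
-- Let D ≥ 0 have rank ≥ 1 and degree ≤ 2.  Some copy T_b has no chip
-- of D; put a chip q on it and write E + q - D = Δf with E ≥ 0.  Cutting 𝒯(T) at a
-- level of f, the edges leaving the sublevel set number at most deg D ≤ 2, which
-- forces f to be constant on the triangles over S.  Then no flow leaves T_b, so
-- E + q and D have the same number of chips on T_b -- absurd.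

module FiniteSums where

  open import Defs
  open import Data.Nat as ℕ using (ℕ; zero; suc)
  open import Data.Integer using (ℤ; _+_; _-_; _*_; -_; _≤_; 0ℤ)
  import Data.Integer.Properties as ℤP
  open import Data.Fin using (Fin; zero; suc; _↑ˡ_; _↑ʳ_; combine; punchIn; punchOut)
  import Data.Fin.Properties as FinP
  open import Relation.Binary.PropositionalEquality
  open import Function using (_∘_)
  open import Data.Integer.Tactic.RingSolver using (solve-∀)

  ∑-cong : ∀ {m} {f g : Fin m → ℤ} → (∀ i → f i ≡ g i) → ∑ f ≡ ∑ g
  ∑-cong {zero}  f≡g = refl
  ∑-cong {suc m} f≡g = cong₂ _+_ (f≡g zero) (∑-cong (λ i → f≡g (suc i)))

  ∑-zero : ∀ {m} → ∑ {m} (λ _ → 0ℤ) ≡ 0ℤ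
  ∑-zero {zero}  = refl
  ∑-zero {suc m} = trans (ℤP.+-identityˡ _) (∑-zero {m})

  ∑-+ : ∀ {m} (f g : Fin m → ℤ) → ∑ (λ i → f i + g i) ≡ ∑ f + ∑ g
  ∑-+ {zero}  f g = refl
  ∑-+ {suc m} f g =
    trans (cong (_+_ (f zero + g zero)) (∑-+ (λ i → f (suc i)) (λ i → g (suc i))))
          (interchange (f zero) (g zero) _ _)
    where interchange : ∀ a b c d → a + b + (c + d) ≡ a + c + (b + d)
          interchange = solve-∀

  ∑-neg : ∀ {m} (f : Fin m → ℤ) → ∑ (λ i → - f i) ≡ - ∑ f
  ∑-neg {zero}  f = refl
  ∑-neg {suc m} f =
    trans (cong (_+_ (- f zero)) (∑-neg (λ i → f (suc i)))) (sym (ℤP.neg-distrib-+ (f zero) _))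

  ∑-- : ∀ {m} (f g : Fin m → ℤ) → ∑ (λ i → f i - g i) ≡ ∑ f - ∑ g
  ∑-- f g = trans (∑-+ f (λ i → - g i)) (cong (_+_ (∑ f)) (∑-neg g))

  ∑-scale : ∀ {m} (c : ℤ) (f : Fin m → ℤ) → ∑ (λ i → c * f i) ≡ c * ∑ f
  ∑-scale {zero}  c f = sym (ℤP.*-zeroʳ c)
  ∑-scale {suc m} c f =
    trans (cong (_+_ (c * f zero)) (∑-scale c (λ i → f (suc i)))) (sym (ℤP.*-distribˡ-+ c (f zero) _))

  ∑-swap : ∀ {m k} (g : Fin m → Fin k → ℤ) → ∑ (λ i → ∑ (λ j → g i j)) ≡ ∑ (λ j → ∑ (λ i → g i j))
  ∑-swap {zero}  {k} g = sym (∑-zero {k})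
  ∑-swap {suc m}     g =
    trans (cong (_+_ (∑ (g zero))) (∑-swap (λ i j → g (suc i) j)))
          (sym (∑-+ (g zero) (λ j → ∑ (λ i → g (suc i) j))))

  ∑-zeros : ∀ {m} {f : Fin m → ℤ} → (∀ i → f i ≡ 0ℤ) → ∑ f ≡ 0ℤ
  ∑-zeros {m} f≡0 = trans (∑-cong f≡0) (∑-zero {m})

  ≤-+-nonnegʳ : ∀ {x y} → 0ℤ ≤ y → x ≤ x + y
  ≤-+-nonnegʳ {x} 0≤y = ℤP.≤-trans (ℤP.≤-reflexive (sym (ℤP.+-identityʳ x))) (ℤP.+-monoʳ-≤ x 0≤y)

  ≤-+-nonnegˡ : ∀ {x y} → 0ℤ ≤ y → x ≤ y + x
  ≤-+-nonnegˡ {x} 0≤y = ℤP.≤-trans (ℤP.≤-reflexive (sym (ℤP.+-identityˡ x))) (ℤP.+-monoˡ-≤ x 0≤y)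

  ∑-nonneg : ∀ {m} {f : Fin m → ℤ} → (∀ i → 0ℤ ≤ f i) → 0ℤ ≤ ∑ f
  ∑-nonneg {zero}  f≥0 = ℤP.≤-refl
  ∑-nonneg {suc m} f≥0 = ℤP.+-mono-≤ (f≥0 zero) (∑-nonneg (λ i → f≥0 (suc i)))

  ∑-mono : ∀ {m} {f g : Fin m → ℤ} → (∀ i → f i ≤ g i) → ∑ f ≤ ∑ g
  ∑-mono {zero}  f≤g = ℤP.≤-refl
  ∑-mono {suc m} f≤g = ℤP.+-mono-≤ (f≤g zero) (∑-mono (λ i → f≤g (suc i)))

  ∑-extract : ∀ {m} (f : Fin (suc m) → ℤ) i → ∑ f ≡ f i + ∑ (λ j → f (punchIn i j))
  ∑-extract         f zero    = refl
  ∑-extract {suc m} f (suc i) =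
    trans (cong (_+_ (f zero)) (∑-extract (λ j → f (suc j)) i)) (left-comm (f zero) (f (suc i)) _)
    where left-comm : ∀ a b c → a + (b + c) ≡ b + (a + c)
          left-comm = solve-∀

  ∑-concentrated : ∀ {m} (f : Fin m → ℤ) k → (∀ i → i ≢ k → f i ≡ 0ℤ) → ∑ f ≡ f k
  ∑-concentrated {suc m} f k vanish = begin
    ∑ f                                  ≡⟨ ∑-extract f k ⟩
    f k + ∑ (λ j → f (punchIn k j))      ≡⟨ cong (_+_ (f k)) (∑-zeros (λ j → vanish _ (FinP.punchInᵢ≢i k j))) ⟩
    f k + 0ℤ                             ≡⟨ ℤP.+-identityʳ (f k) ⟩
    f k                                  ∎
    where open ≡-Reasoning

  term≤∑ : ∀ {m} {f : Fin m → ℤ} → (∀ i → 0ℤ ≤ f i) → ∀ k → f k ≤ ∑ f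
  term≤∑ {suc m} {f} f≥0 k = begin
    f k                                  ≤⟨ ≤-+-nonnegʳ (∑-nonneg (λ j → f≥0 (punchIn k j))) ⟩
    f k + ∑ (λ j → f (punchIn k j))      ≡⟨ ∑-extract f k ⟨
    ∑ f                                  ∎
    where open ℤP.≤-Reasoning

  two-terms≤∑ : ∀ {m} {f : Fin m → ℤ} → (∀ i → 0ℤ ≤ f i) → ∀ {k l} → k ≢ l → f k + f l ≤ ∑ f
  two-terms≤∑ {suc m} {f} f≥0 {k} {l} k≢l = begin
    f k + f l                            ≡⟨ cong (λ j → f k + f j) (FinP.punchIn-punchOut k≢l) ⟨
    f k + f (punchIn k (punchOut k≢l))   ≤⟨ ℤP.+-monoʳ-≤ (f k) (term≤∑ (λ j → f≥0 (punchIn k j)) _) ⟩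
    f k + ∑ (λ j → f (punchIn k j))      ≡⟨ ∑-extract f k ⟨
    ∑ f                                  ∎
    where open ℤP.≤-Reasoning

  three-terms≤∑ : ∀ {m} {f : Fin m → ℤ} → (∀ i → 0ℤ ≤ f i) → ∀ {k l o} → k ≢ l → k ≢ o → l ≢ o →
                  f k + f l + f o ≤ ∑ f
  three-terms≤∑ {suc m} {f} f≥0 {k} {l} {o} k≢l k≢o l≢o = begin
    f k + f l + f o                      ≡⟨ ℤP.+-assoc (f k) (f l) (f o) ⟩
    f k + (f l + f o)                    ≡⟨ cong₂ (λ x y → f k + (f x + f y)) (FinP.punchIn-punchOut k≢l) (FinP.punchIn-punchOut k≢o) ⟨
    f k + (g (punchOut k≢l) + g (punchOut k≢o))
                                         ≤⟨ ℤP.+-monoʳ-≤ (f k) (two-terms≤∑ (λ j → f≥0 (punchIn k j)) (l≢o ∘ FinP.punchOut-injective k≢l k≢o)) ⟩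
    f k + ∑ g                            ≡⟨ ∑-extract f k ⟨
    ∑ f                                  ∎
    where open ℤP.≤-Reasoning
          g : Fin m → ℤ
          g j = f (punchIn k j)

  ∑-++ : ∀ {k l} (g : Fin (k ℕ.+ l) → ℤ) → ∑ g ≡ ∑ (λ i → g (i ↑ˡ l)) + ∑ (λ j → g (k ↑ʳ j))
  ∑-++ {zero}      g = sym (ℤP.+-identityˡ _)
  ∑-++ {suc k} {l} g = trans (cong (_+_ (g zero)) (∑-++ {k} {l} (λ i → g (suc i)))) (sym (ℤP.+-assoc (g zero) _ _))

  ∑-combine : ∀ {m k} (g : Fin (m ℕ.* k) → ℤ) → ∑ g ≡ ∑ (λ (a : Fin m) → ∑ (λ (v : Fin k) → g (combine a v)))
  ∑-combine {zero}      g = refl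
  ∑-combine {suc m} {k} g =
    trans (∑-++ {k} {m ℕ.* k} g) (cong (_+_ (∑ (λ v → g (combine {suc m} {k} zero v)))) (∑-combine {m} {k} (λ i → g (k ↑ʳ i))))

  ∑-antisymmetric : ∀ {k} (M : Fin k → Fin k → ℤ) → (∀ i j → M i j ≡ M j i) → (g : Fin k → ℤ) →
                    ∑ (λ i → ∑ (λ j → M i j * (g i - g j))) ≡ 0ℤ
  ∑-antisymmetric M M-sym g = begin
    ∑ (λ i → ∑ (λ j → M i j * (g i - g j)))               ≡⟨ ∑-cong (λ i → ∑-cong (λ j → distribˡ-- (M i j) (g i) (g j))) ⟩
    ∑ (λ i → ∑ (λ j → M i j * g i - M i j * g j))          ≡⟨ ∑-cong (λ i → ∑-- (λ j → M i j * g i) (λ j → M i j * g j)) ⟩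
    ∑ (λ i → ∑ (λ j → M i j * g i) - ∑ (λ j → M i j * g j)) ≡⟨ ∑-- (λ i → ∑ (λ j → M i j * g i)) (λ i → ∑ (λ j → M i j * g j)) ⟩
    P - ∑ (λ i → ∑ (λ j → M i j * g j))                    ≡⟨ cong (_-_ P) (∑-swap (λ i j → M i j * g j)) ⟩
    P - ∑ (λ j → ∑ (λ i → M i j * g j))                    ≡⟨ cong (_-_ P) (∑-cong (λ j → ∑-cong (λ i → cong (_* g j) (M-sym i j)))) ⟩
    P - P                                                  ≡⟨ ℤP.+-inverseʳ P ⟩
    0ℤ                                                     ∎
    where open ≡-Reasoning
          P : ℤ
          P = ∑ (λ i → ∑ (λ j → M i j * g i))
          distribˡ-- : ∀ a b c → a * (b - c) ≡ a * b - a * c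
          distribˡ-- = solve-∀

module Divisors where

  open import Defs
  open FiniteSums
  open import Data.Nat using (zero; suc; s≤s; z≤n)
  open import Data.Integer as ℤ using (ℤ; +_; _+_; _-_; _*_; -_; _≤_; _<_; 0ℤ; 1ℤ; +≤+; +<+)
  import Data.Integer.Properties as ℤP
  open import Data.Fin using (Fin; zero; suc; _≟_)
  open import Data.Bool using (Bool; if_then_else_)
  open import Data.Product using (∃; _,_)
  open import Relation.Nullary using (yes; no)
  open import Relation.Nullary.Decidable using (⌊_⌋)
  open import Relation.Binary.PropositionalEquality
  open import Data.Empty using (⊥-elim)
  open import Data.Integer.Tactic.RingSolver using (solve-∀)

  outflow : ∀ {m} → EdgeCount m → (Fin m → ℤ) → Fin m → ℤ
  outflow e f i = ∑ (λ j → + e i j * (f i - f j))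

  laplacian-outflow : ∀ {m} (e : EdgeCount m) → (∀ i → e i i ≡ 0) → ∀ f i →
                      ∑ (λ j → laplacian e i j * f j) ≡ outflow e f i
  laplacian-outflow {m} e loopless f i = begin
    ∑ (λ j → laplacian e i j * f j)                    ≡⟨ ∑-cong entry ⟩
    ∑ (λ j → diagonal j - + e i j * f j)               ≡⟨ ∑-- diagonal (λ j → + e i j * f j) ⟩
    ∑ diagonal - ∑ (λ j → + e i j * f j)               ≡⟨ cong (_- neighbour-sum) (∑-concentrated diagonal i off-diagonal) ⟩
    diagonal i - ∑ (λ j → + e i j * f j)               ≡⟨ cong (_- neighbour-sum) diagonal-at-i ⟩
    valence e i * f i - ∑ (λ j → + e i j * f j)        ≡⟨ cong (_- neighbour-sum) valence-term ⟨
    ∑ (λ j → + e i j * f i) - ∑ (λ j → + e i j * f j)  ≡⟨ ∑-- (λ j → + e i j * f i) (λ j → + e i j * f j) ⟨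
    ∑ (λ j → + e i j * f i - + e i j * f j)            ≡⟨ ∑-cong (λ j → distribˡ-- (+ e i j) (f i) (f j)) ⟨
    outflow e f i                                      ∎
    where
    open ≡-Reasoning
    neighbour-sum : ℤ
    neighbour-sum = ∑ (λ j → + e i j * f j)
    diagonal : Fin m → ℤ
    diagonal j = if ⌊ i ≟ j ⌋ then valence e i * f i else 0ℤ
    distribˡ-- : ∀ a b c → a * (b - c) ≡ a * b - a * c
    distribˡ-- = solve-∀
    entry : ∀ j → laplacian e i j * f j ≡ diagonal j - + e i j * f j
    entry j with i ≟ j
    ... | yes refl = trans (sym (ℤP.+-identityʳ _)) (cong (λ k → valence e i * f i - + k * f i) (sym (loopless i)))
    ... | no _     = trans (sym (ℤP.neg-distribˡ-* (+ e i j) (f j))) (sym (ℤP.+-identityˡ _))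
    off-diagonal : ∀ j → j ≢ i → diagonal j ≡ 0ℤ
    off-diagonal j j≢i with i ≟ j
    ... | yes refl = ⊥-elim (j≢i refl)
    ... | no _     = refl
    diagonal-at-i : diagonal i ≡ valence e i * f i
    diagonal-at-i with i ≟ i
    ... | yes _  = refl
    ... | no i≢i = ⊥-elim (i≢i refl)
    valence-term : ∑ (λ j → + e i j * f i) ≡ valence e i * f i
    valence-term = trans (∑-cong (λ j → ℤP.*-comm (+ e i j) (f i)))
                         (trans (∑-scale (f i) (λ j → + e i j)) (ℤP.*-comm (f i) _))

  InLaplacianImage-resp : ∀ {m} (e : EdgeCount m) {D D' : Divisor m} → (∀ i → D i ≡ D' i) →
                          InLaplacianImage e D → InLaplacianImage e D'
  InLaplacianImage-resp e D≡D' (f , D=Δf) = f , (λ v → trans (sym (D≡D' v)) (D=Δf v))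

  InLaplacianImage-+ : ∀ {m} (e : EdgeCount m) {D₁ D₂ : Divisor m} →
                       InLaplacianImage e D₁ → InLaplacianImage e D₂ → InLaplacianImage e (λ i → D₁ i + D₂ i)
  InLaplacianImage-+ e (f₁ , D₁=Δf₁) (f₂ , D₂=Δf₂) =
    (λ w → f₁ w + f₂ w) ,
    (λ v → trans (cong₂ _+_ (D₁=Δf₁ v) (D₂=Δf₂ v))
                 (sym (trans (∑-cong (λ w → ℤP.*-distribˡ-+ (laplacian e v w) (f₁ w) (f₂ w)))
                             (∑-+ (λ w → laplacian e v w * f₁ w) (λ w → laplacian e v w * f₂ w)))))

  LinEquiv-equal : ∀ {m} (e : EdgeCount m) {D D' : Divisor m} → (∀ i → D i ≡ D' i) → LinEquiv e D D'
  LinEquiv-equal {m} e {D} {D'} D≡D' =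
    InLaplacianImage-resp e (λ i → sym (trans (cong (_-_ (D i)) (sym (D≡D' i))) (ℤP.+-inverseʳ (D i))))
      ((λ _ → 0ℤ) , (λ v → sym (trans (∑-cong (λ w → ℤP.*-zeroʳ (laplacian e v w))) (∑-zero {m}))))

  LinEquiv-trans : ∀ {m} (e : EdgeCount m) {D₁ D₂ D₃ : Divisor m} →
                   LinEquiv e D₁ D₂ → LinEquiv e D₂ D₃ → LinEquiv e D₁ D₃
  LinEquiv-trans e {D₁} {D₂} {D₃} D₁~D₂ D₂~D₃ =
    InLaplacianImage-resp e (λ i → telescope (D₁ i) (D₂ i) (D₃ i)) (InLaplacianImage-+ e D₁~D₂ D₂~D₃)
    where telescope : ∀ a b c → (a - b) + (b - c) ≡ a - c
          telescope = solve-∀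

  LinEquiv-shift : ∀ {m} (e : EdgeCount m) {D D' : Divisor m} (F : Divisor m) →
                   LinEquiv e D D' → LinEquiv e (λ i → D i - F i) (λ i → D' i - F i)
  LinEquiv-shift e {D} {D'} F = InLaplacianImage-resp e (λ i → cancel (D i) (D' i) (F i))
    where cancel : ∀ a b f → a - b ≡ (a - f) - (b - f)
          cancel = solve-∀

  potential⇒LinEquiv : ∀ {m} (e : EdgeCount m) → (∀ i → e i i ≡ 0) → ∀ {D D' : Divisor m} f →
                       (∀ i → D i - D' i ≡ outflow e f i) → LinEquiv e D D'
  potential⇒LinEquiv e loopless f D-D'=flow = f , (λ i → trans (D-D'=flow i) (sym (laplacian-outflow e loopless f i)))

  LinEquiv⇒potential : ∀ {m} (e : EdgeCount m) → (∀ i → e i i ≡ 0) → ∀ {D D' : Divisor m} →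
                       LinEquiv e D D' → ∃ λ f → ∀ i → D i - D' i ≡ outflow e f i
  LinEquiv⇒potential e loopless (f , D-D'=Δf) = f , (λ i → trans (D-D'=Δf i) (laplacian-outflow e loopless f i))

  indicator : Bool → ℤ
  indicator b = if b then 1ℤ else 0ℤ

  point : ∀ {m} → Fin m → Divisor m
  point q i = indicator ⌊ i ≟ q ⌋

  point-effective : ∀ {m} (q : Fin m) → Effective (point q)
  point-effective q i with i ≟ q
  ... | yes _ = +≤+ z≤n
  ... | no _  = +≤+ z≤n

  point-at : ∀ {m} (q : Fin m) → point q q ≡ 1ℤ
  point-at q with q ≟ q
  ... | yes _  = refl
  ... | no q≢q = ⊥-elim (q≢q refl)

  point-deg : ∀ {m} (q : Fin m) → deg (point q) ≡ + 1
  point-deg q = trans (∑-concentrated (point q) q off-q) (point-at q)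
    where off-q : ∀ i → i ≢ q → point q i ≡ 0ℤ
          off-q i i≢q with i ≟ q
          ... | yes i≡q = ⊥-elim (i≢q i≡q)
          ... | no _    = refl

  degree-zero : ∀ {m} (F : Divisor m) → Effective F → deg F ≡ 0ℤ → ∀ i → F i ≡ 0ℤ
  degree-zero F effF deg≡0 i = ℤP.≤-antisym (ℤP.≤-trans (term≤∑ effF i) (ℤP.≤-reflexive deg≡0)) (effF i)

  positive-term : ∀ {m} (g : Fin m → ℤ) → 0ℤ < ∑ g → ∃ λ i → 0ℤ < g i
  positive-term {zero}  g (+<+ ())
  positive-term {suc m} g 0<∑ with 0ℤ ℤ.<? g zero
  ... | yes 0<g₀ = zero , 0<g₀
  ... | no 0≮g₀ with positive-term (λ i → g (suc i)) (ℤP.≰⇒> (λ rest≤0 → ℤP.<⇒≱ 0<∑ (ℤP.+-mono-≤ (ℤP.≮⇒≥ 0≮g₀) rest≤0)))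
  ...   | i , 0<gᵢ = suc i , 0<gᵢ

  degree-one : ∀ {m} (F : Divisor m) → Effective F → deg F ≡ + 1 → ∃ λ q → ∀ i → F i ≡ point q i
  degree-one F effF deg≡1 with positive-term F (ℤP.<-≤-trans (+<+ (s≤s z≤n)) (ℤP.≤-reflexive (sym deg≡1)))
  ... | q , 0<Fq = q , at
    where
    1≤Fq : + 1 ≤ F q
    1≤Fq = ℤP.i<j⇒suc[i]≤j 0<Fq
    at : ∀ i → F i ≡ point q i
    at i with i ≟ q
    ... | yes refl = ℤP.≤-antisym (ℤP.≤-trans (term≤∑ effF q) (ℤP.≤-reflexive deg≡1)) 1≤Fq
    ... | no i≢q   = ℤP.≤-antisym Fi≤0 (effF i)
      where
      Fi≤0 : F i ≤ 0ℤ
      Fi≤0 = begin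
        F i                    ≡⟨ add-sub (F i) (F q) ⟩
        (F i + F q) - F q      ≤⟨ ℤP.+-monoˡ-≤ (- F q) (ℤP.≤-trans (two-terms≤∑ effF i≢q) (ℤP.≤-reflexive deg≡1)) ⟩
        + 1 - F q              ≤⟨ ℤP.+-monoˡ-≤ (- F q) 1≤Fq ⟩
        F q - F q              ≡⟨ ℤP.+-inverseʳ (F q) ⟩
        0ℤ                     ∎
        where open ℤP.≤-Reasoning
              add-sub : ∀ a b → a ≡ (a + b) - b
              add-sub = solve-∀

module LevelSets where

  open import Defs
  open FiniteSums
  open Divisors
  open import Data.Nat as ℕ using (ℕ; zero; suc; s≤s; z≤n)
  open import Data.Integer as ℤ using (ℤ; +_; _+_; _-_; _*_; -_; _≤_; _<_; 0ℤ; 1ℤ; +≤+; _≤?_)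
  import Data.Integer.Properties as ℤP
  open import Data.Fin using (Fin)
  open import Relation.Nullary using (¬_; yes; no)
  open import Relation.Nullary.Decidable using (⌊_⌋)
  open import Relation.Binary.PropositionalEquality
  open import Data.Empty using (⊥-elim)
  open import Data.Integer.Tactic.RingSolver using (solve-∀)

  multiple-nonneg : ∀ k (d : ℤ) → 0ℤ ≤ d → 0ℤ ≤ + k * d
  multiple-nonneg k (+ d) _ rewrite ℤP.+◃n≡+n (k ℕ.* d) = +≤+ z≤n

  multiple-pos : ∀ k (d : ℤ) → 1 ℕ.≤ k → + 1 ≤ d → + 1 ≤ + k * d
  multiple-pos (suc k) (+ suc d) _ _        = +≤+ (s≤s z≤n)
  multiple-pos (suc k) (+ zero)  _ (+≤+ ())

  gap : ∀ {a b : ℤ} → a < b → + 1 ≤ b - a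
  gap {a} {b} a<b = begin
    + 1                ≡⟨ cancel a ⟩
    (+ 1 + a) - a      ≤⟨ ℤP.+-monoˡ-≤ (- a) (ℤP.i<j⇒suc[i]≤j a<b) ⟩
    b - a              ∎
    where open ℤP.≤-Reasoning
          cancel : ∀ (a : ℤ) → + 1 ≡ (+ 1 + a) - a
          cancel = solve-∀

  -- For a threshold t, each edge from the
  -- sublevel set {f ≤ t} to its complement carries a flow f j - f i ≥ 1 out of it,
  -- and the total flow leaving the sublevel set is ∑_{f i ≤ t} (D i - F i) ≤ deg D.
  -- So a divisor of small degree admits only few crossing edges at every level.
  module LevelSetCut {m} (e : EdgeCount m) (e-sym : ∀ i j → e i j ≡ e j i)
    (D F f : Divisor m) (effD : Effective D) (effF : Effective F)
    (F-D=flow : ∀ i → F i - D i ≡ outflow e f i) where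

    below : ℤ → Fin m → ℤ
    below t i = indicator ⌊ f i ≤? t ⌋

    crossing : ℤ → Fin m → Fin m → ℤ
    crossing t i j = below t i * ((1ℤ - below t j) * (+ e i j * (f j - f i)))

    cut : ℤ → ℤ
    cut t = ∑ (λ i → ∑ (λ j → crossing t i j))

    crossing-nonneg : ∀ t i j → 0ℤ ≤ crossing t i j
    crossing-nonneg t i j with f i ≤? t | f j ≤? t
    ... | no _     | _      = ℤP.≤-refl
    ... | yes _    | yes _  = ℤP.≤-refl
    ... | yes fi≤t | no fj≰t =
      ℤP.≤-trans (multiple-nonneg (e i j) (f j - f i) (ℤP.i≤j⇒0≤j-i (ℤP.<⇒≤ (ℤP.≤-<-trans fi≤t (ℤP.≰⇒> fj≰t)))))
                 (ℤP.≤-reflexive (unit-factors (+ e i j * (f j - f i))))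
      where unit-factors : ∀ x → x ≡ 1ℤ * ((1ℤ - 0ℤ) * x)
            unit-factors = solve-∀

    crossing-edge : ∀ t i j → f i ≤ t → ¬ (f j ≤ t) → 1 ℕ.≤ e i j → + 1 ≤ crossing t i j
    crossing-edge t i j fi≤t fj≰t edge with f i ≤? t | f j ≤? t
    ... | no fi≰t | _      = ⊥-elim (fi≰t fi≤t)
    ... | yes _   | yes fj≤t = ⊥-elim (fj≰t fj≤t)
    ... | yes _   | no _   =
      ℤP.≤-trans (multiple-pos (e i j) (f j - f i) edge (gap (ℤP.≤-<-trans fi≤t (ℤP.≰⇒> fj≰t))))
                 (ℤP.≤-reflexive (unit-factors (+ e i j * (f j - f i))))
      where unit-factors : ∀ x → x ≡ 1ℤ * ((1ℤ - 0ℤ) * x)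
            unit-factors = solve-∀

    -- restricted to the sublevel set, the flow along inner edges cancels,
    -- so the outflow of the sublevel set is exactly its cut
    sublevel-balance : ∀ t → ∑ (λ i → below t i * (F i - D i)) ≡ - cut t
    sublevel-balance t = begin
      ∑ (λ i → below t i * (F i - D i))
        ≡⟨ ∑-cong (λ i → cong (below t i *_) (F-D=flow i)) ⟩
      ∑ (λ i → below t i * outflow e f i)
        ≡⟨ ∑-cong (λ i → sym (∑-scale (below t i) (λ j → + e i j * (f i - f j)))) ⟩
      ∑ (λ i → ∑ (λ j → below t i * (+ e i j * (f i - f j))))
        ≡⟨ ∑-cong (λ i → ∑-cong (λ j → split-edge (below t i) (below t j) (+ e i j) (f i) (f j))) ⟩
      ∑ (λ i → ∑ (λ j → inner i j * (f i - f j) - crossing t i j))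
        ≡⟨ ∑-cong (λ i → ∑-- (λ j → inner i j * (f i - f j)) (crossing t i)) ⟩
      ∑ (λ i → ∑ (λ j → inner i j * (f i - f j)) - ∑ (crossing t i))
        ≡⟨ ∑-- (λ i → ∑ (λ j → inner i j * (f i - f j))) (λ i → ∑ (crossing t i)) ⟩
      ∑ (λ i → ∑ (λ j → inner i j * (f i - f j))) - cut t
        ≡⟨ cong (_- cut t) (∑-antisymmetric inner inner-sym f) ⟩
      0ℤ - cut t
        ≡⟨ ℤP.+-identityˡ _ ⟩
      - cut t ∎
      where
      open ≡-Reasoning
      inner : Fin m → Fin m → ℤ
      inner i j = below t i * below t j * + e i j
      inner-sym : ∀ i j → inner i j ≡ inner j i
      inner-sym i j = cong₂ (λ x k → x * + k) (ℤP.*-comm (below t i) (below t j)) (e-sym i j)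
      split-edge : ∀ a b x p q → a * (x * (p - q)) ≡ a * b * x * (p - q) - a * ((1ℤ - b) * (x * (q - p)))
      split-edge = solve-∀

    cut≤deg : ∀ t → cut t ≤ deg D
    cut≤deg t = begin
      cut t                                         ≡⟨ ℤP.neg-involutive (cut t) ⟨
      - - cut t                                     ≡⟨ cong -_ (sublevel-balance t) ⟨
      - ∑ (λ i → below t i * (F i - D i))           ≡⟨ ∑-neg (λ i → below t i * (F i - D i)) ⟨
      ∑ (λ i → - (below t i * (F i - D i)))         ≤⟨ ∑-mono bounded-by-D ⟩
      ∑ D                                           ∎
      where
      open ℤP.≤-Reasoning
      bounded-by-D : ∀ i → - (below t i * (F i - D i)) ≤ D i
      bounded-by-D i with f i ≤? t
      ... | no _  = effD i
      ... | yes _ = begin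
        - (1ℤ * (F i - D i))   ≡⟨ flip-sign (F i) (D i) ⟩
        D i + - F i            ≤⟨ ℤP.+-monoʳ-≤ (D i) (ℤP.neg-mono-≤ (effF i)) ⟩
        D i + 0ℤ               ≡⟨ ℤP.+-identityʳ (D i) ⟩
        D i                    ∎
        where flip-sign : ∀ a b → - (1ℤ * (a - b)) ≡ b + - a
              flip-sign = solve-∀

module Trees where

  open import Defs
  open FiniteSums
  open Divisors
  open import Data.Nat as ℕ using (ℕ; zero; suc; s≤s; z≤n)
  import Data.Nat.Properties as ℕP
  open import Data.Integer using (ℤ; +_; _-_; _*_; -_; 0ℤ; 1ℤ)
  import Data.Integer.Properties as ℤP
  open import Data.Fin using (Fin; zero; suc; _≟_; punchOut)
  import Data.Fin.Properties as FinP
  open import Data.Bool using (Bool; true; false; _∨_; if_then_else_)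
  import Data.Bool.Properties as BoolP
  open import Data.List using (List; []; _∷_; length; _∷ʳ_)
  open import Data.List.Relation.Unary.All using (All; []; _∷_)
  import Data.List.Relation.Unary.All.Properties as AllP
  open import Data.List.Relation.Unary.Any using (here; there)
  open import Data.List.Relation.Unary.AllPairs using ([]; _∷_)
  open import Data.List.Relation.Unary.Linked using (Linked; [-]; _∷_)
  open import Data.List.Relation.Unary.Unique.Propositional using (Unique)
  open import Data.List.Membership.Propositional using (_∈_)
  open import Data.Product using (∃; _×_; _,_; proj₁; proj₂)
  open import Relation.Nullary using (¬_; yes; no; Dec)
  open import Relation.Nullary.Decidable using (⌊_⌋; _×-dec_; ¬?; isYes≗does; dec-true)
  open import Relation.Binary.PropositionalEquality
  open import Data.Empty using (⊥; ⊥-elim)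
  open import Function using (_∘_)

  -- A list of distinct elements of Fin k has at most k entries: after the head x,
  -- the remaining entries avoid x, so punchOut x moves them injectively into Fin (k - 1).
  punchOut-all : ∀ {k} (x : Fin (suc k)) (ys : List (Fin (suc k))) → All (x ≢_) ys → List (Fin k)
  punchOut-all x []       []           = []
  punchOut-all x (y ∷ ys) (x≢y ∷ x≢ys) = punchOut x≢y ∷ punchOut-all x ys x≢ys

  punchOut-all-length : ∀ {k} (x : Fin (suc k)) ys x≢ys → length (punchOut-all {k} x ys x≢ys) ≡ length ys
  punchOut-all-length x []       []          = refl
  punchOut-all-length x (y ∷ ys) (_ ∷ x≢ys) = cong suc (punchOut-all-length x ys x≢ys)

  punchOut-all-avoids : ∀ {k} {x y : Fin (suc k)} (x≢y : x ≢ y) ys x≢ys → All (y ≢_) ys →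
                        All (punchOut x≢y ≢_) (punchOut-all x ys x≢ys)
  punchOut-all-avoids x≢y []       []            []            = []
  punchOut-all-avoids x≢y (z ∷ ys) (x≢z ∷ x≢ys) (y≢z ∷ y≢ys) =
    (λ eq → y≢z (FinP.punchOut-injective x≢y x≢z eq)) ∷ punchOut-all-avoids x≢y ys x≢ys y≢ys

  punchOut-all-unique : ∀ {k} (x : Fin (suc k)) ys x≢ys → Unique ys → Unique (punchOut-all x ys x≢ys)
  punchOut-all-unique x []       []           []               = []
  punchOut-all-unique x (y ∷ ys) (x≢y ∷ x≢ys) (y≢ys ∷ unique) =
    punchOut-all-avoids x≢y ys x≢ys y≢ys ∷ punchOut-all-unique x ys x≢ys unique

  unique-length : ∀ {k} (xs : List (Fin k)) → Unique xs → length xs ℕ.≤ k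
  unique-length {zero}  []       _ = z≤n
  unique-length {suc k} []       _ = z≤n
  unique-length {suc k} (x ∷ xs) (x≢xs ∷ unique) =
    s≤s (subst (ℕ._≤ k) (punchOut-all-length x xs x≢xs)
               (unique-length (punchOut-all x xs x≢xs) (punchOut-all-unique x xs x≢xs unique)))

  module Paths {n : ℕ} (_⟶_ : Fin n → Fin n → Set) where
    open import Data.List.Membership.DecPropositional (_≟_ {n}) using (_∈?_)

    data Path : Fin n → Fin n → List (Fin n) → Set where
      [_] : ∀ v → Path v v (v ∷ [])
      _∷_ : ∀ {u v w vs} → u ⟶ v → Path v w vs → Path u w (u ∷ vs)

    suffix : ∀ {u w vs z} → Path u w vs → z ∈ vs → ∃ λ suf → Path z w suf × (Unique vs → Unique suf)
    suffix [ _ ]   (here refl) = _ , [ _ ] , (λ unique → unique)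
    suffix (s ∷ p) (here refl) = _ , s ∷ p , (λ unique → unique)
    suffix (s ∷ p) (there z∈vs) with suffix p z∈vs
    ... | suf , p' , keeps = suf , p' , (λ { (_ ∷ unique) → keeps unique })

    shorten : ∀ {u w vs} → Path u w vs → ∃ λ vs' → Path u w vs' × Unique vs'
    shorten [ v ] = _ , [ v ] , ([] ∷ [])
    shorten {u} (s ∷ p) with shorten p
    ... | vs' , p' , unique with u ∈? vs'
    ...   | yes u∈vs' with suffix p' u∈vs'
    ...     | suf , p'' , keeps = suf , p'' , keeps unique
    shorten {u} (s ∷ p) | vs' , p' , unique | no u∉vs' = u ∷ vs' , s ∷ p' , (AllP.¬Any⇒All¬ vs' u∉vs' ∷ unique)

  -- Deleting an edge x y from a tree disconnects it: the vertices reachable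
  -- from x without that edge form a side containing x but not y (a path back
  -- from y would close a cycle), and no other edge leaves the side.  The side
  -- is computed as the set of vertices reaching x in at most n steps, which is
  -- enough since paths can be shortened to have distinct vertices.
  module EdgeCut (n : ℕ) (adj : SimpleAdj n) (adj-sym : IsSymmetric adj) (adj-loopless : IsLoopless adj)
    (acyclic : IsAcyclic adj) (x y : Fin n) (xy : Edge adj x y) where

    OtherEdge : Fin n → Fin n → Set
    OtherEdge z w = Edge adj z w × ¬ (z ≡ x × w ≡ y) × ¬ (z ≡ y × w ≡ x)

    other? : ∀ z w → Dec (OtherEdge z w)
    other? z w = (adj z w BoolP.≟ true) ×-dec ¬? ((z ≟ x) ×-dec (w ≟ y)) ×-dec ¬? ((z ≟ y) ×-dec (w ≟ x))

    OtherEdge-sym : ∀ {z w} → OtherEdge z w → OtherEdge w z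
    OtherEdge-sym {z} {w} (zw , not-xy , not-yx) =
      trans (adj-sym w z) zw , (λ { (w≡x , z≡y) → not-yx (z≡y , w≡x) }) , (λ { (w≡y , z≡x) → not-xy (z≡x , w≡y) })

    x≢y : x ≢ y
    x≢y refl with () ← trans (sym (adj-loopless x)) xy

    open Paths OtherEdge

    -- reach k z: z reaches x in at most k steps along other edges
    reach : ℕ → Fin n → Bool
    onward? : ∀ k z → Dec (∃ λ w → OtherEdge z w × reach k w ≡ true)

    reach zero    z = ⌊ z ≟ x ⌋
    reach (suc k) z = reach k z ∨ ⌊ onward? k z ⌋

    onward? k z = FinP.any? (λ w → other? z w ×-dec (reach k w BoolP.≟ true))

    reach-x : ∀ k → reach k x ≡ true
    reach-x zero with x ≟ x
    ... | yes _  = refl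
    ... | no x≢x = ⊥-elim (x≢x refl)
    reach-x (suc k) = cong (_∨ ⌊ onward? k x ⌋) (reach-x k)

    reach-sound : ∀ k z → reach k z ≡ true → ∃ λ vs → Path z x vs
    reach-sound zero z reached with z ≟ x
    ... | yes refl = _ , [ x ]
    reach-sound (suc k) z reached with reach k z in reached-k
    ... | true = reach-sound k z reached-k
    ... | false with onward? k z
    ...   | yes (w , zw , reached-w) = _ , zw ∷ proj₂ (reach-sound k w reached-w)

    reach-complete : ∀ {z vs} → Path z x vs → ∀ k → length vs ℕ.≤ suc k → reach k z ≡ true
    reach-complete [ _ ]                 k       _         = reach-x k
    reach-complete (zw ∷ [ _ ])          zero    (s≤s ())
    reach-complete (zw ∷ (_ ∷ _))        zero    (s≤s ())
    reach-complete {z} (_∷_ {v = w} zw p) (suc k) (s≤s len) =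
      trans (cong (reach k z ∨_) found) (BoolP.∨-zeroʳ (reach k z))
      where found : ⌊ onward? k z ⌋ ≡ true
            found = trans (isYes≗does (onward? k z)) (dec-true (onward? k z) (w , zw , reach-complete p k len))

    side : Fin n → Bool
    side = reach n

    side-x : side x ≡ true
    side-x = reach-x n

    -- an other edge into the side comes from the side: shorten the path through it
    side-step : ∀ {w z} → OtherEdge w z → side z ≡ true → side w ≡ true
    side-step wz z-side with reach-sound n _ z-side
    ... | _ , p with shorten (wz ∷ p)
    ...   | vs , p' , unique = reach-complete p' n (ℕP.m≤n⇒m≤1+n (unique-length vs unique))

    side-respects : ∀ {z w} → OtherEdge z w → side z ≡ side w
    side-respects {z} {w} zw with side z in z-side | side w in w-side
    ... | true  | true  = refl
    ... | false | false = refl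
    ... | true  | false = sym (trans (sym w-side) (side-step (OtherEdge-sym zw) z-side))
    ... | false | true  = trans (sym z-side) (side-step zw w-side)

    -- a path y ⇝ x with distinct vertices, followed by the edge x y, is a cycle
    side-y : side y ≡ false
    side-y with side y in y-side
    ... | false = refl
    ... | true with reach-sound n y y-side
    ...   | _ , p with shorten p
    ...     | _ , p' , unique = ⊥-elim (closes-cycle p' unique)
      where
      nonempty : ∀ {a b vs} → Path a b vs → 1 ℕ.≤ length vs
      nonempty [ _ ]   = s≤s z≤n
      nonempty (_ ∷ _) = s≤s z≤n
      linked : ∀ {u w vs} → Path u w vs → Edge adj w y → Linked (Edge adj) (vs ∷ʳ y)
      linked [ _ ]             wy = wy ∷ [-]
      linked (s ∷ [ _ ])       wy = proj₁ s ∷ (wy ∷ [-])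
      linked (s ∷ p@(_ ∷ _))   wy = proj₁ s ∷ linked p wy
      closes-cycle : ∀ {vs} → Path y x vs → Unique vs → ⊥
      closes-cycle [ _ ]                         _      = x≢y refl
      closes-cycle (s ∷ [ _ ])                   _      = proj₂ (proj₂ s) (refl , refl)
      closes-cycle (_∷_ {vs = vs} s p@(_ ∷ q))   unique =
        acyclic (y ∷ vs) (s≤s (s≤s (nonempty q)) , unique , linked (s ∷ p) xy)

  treeEdges : ∀ {n} → SimpleAdj n → EdgeCount n
  treeEdges adj v w = if adj v w then 1 else 0

  -- Across an edge x y of a tree, the indicator of the side of x is a potential
  -- whose outflow is a chip at x minus a chip at y: every other edge has both
  -- ends on the same side.
  module SidePotential (n : ℕ) (adj : SimpleAdj n) (adj-sym : IsSymmetric adj) (adj-loopless : IsLoopless adj)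
    (acyclic : IsAcyclic adj) (x y : Fin n) (xy : Edge adj x y) where

    open EdgeCut n adj adj-sym adj-loopless acyclic x y xy

    potential : Fin n → ℤ
    potential z = indicator (side z)

    flow : Fin n → Fin n → ℤ
    flow z w = + treeEdges adj z w * (potential z - potential w)

    flow-vanishes : ∀ {z w} → (Edge adj z w → side z ≡ side w) → flow z w ≡ 0ℤ
    flow-vanishes {z} {w} same-side with adj z w
    ... | false = refl
    ... | true  = trans (ℤP.*-identityˡ _)
                        (trans (cong (λ b → indicator b - potential w) (same-side refl))
                               (ℤP.+-inverseʳ (potential w)))

    flow-xy : flow x y ≡ 1ℤ
    flow-xy = trans (cong (λ b → + (if b then 1 else 0) * (potential x - potential y)) xy)
                    (cong₂ (λ s t → + 1 * (indicator s - indicator t)) side-x side-y)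

    flow-yx : flow y x ≡ - 1ℤ
    flow-yx = trans (cong (λ b → + (if b then 1 else 0) * (potential y - potential x)) (trans (adj-sym y x) xy))
                    (cong₂ (λ s t → + 1 * (indicator s - indicator t)) side-y side-x)

    same-side : ∀ {z w} → ¬ (z ≡ x × w ≡ y) → ¬ (z ≡ y × w ≡ x) → Edge adj z w → side z ≡ side w
    same-side not-xy not-yx zw = side-respects (zw , not-xy , not-yx)

    side-outflow : ∀ z → outflow (treeEdges adj) potential z ≡ point x z - point y z
    side-outflow z with z ≟ x | z ≟ y
    ... | yes refl | yes x≡y = ⊥-elim (x≢y x≡y)
    ... | yes refl | no z≢y  =
      trans (∑-concentrated (flow x) y (λ w w≢y → flow-vanishes (same-side (w≢y ∘ proj₂) (z≢y ∘ proj₁)))) flow-xy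
    ... | no z≢x   | yes refl =
      trans (∑-concentrated (flow y) x (λ w w≢x → flow-vanishes (same-side (z≢x ∘ proj₁) (w≢x ∘ proj₂)))) flow-yx
    ... | no z≢x   | no z≢y  =
      ∑-zeros (λ w → flow-vanishes {z} {w} (same-side (z≢x ∘ proj₁) (z≢y ∘ proj₁)))

module TriplicatedGraph where

  open import Defs
  open import Data.Nat as ℕ using (ℕ; s≤s; z≤n)
  open import Data.Fin using (Fin; combine; remQuot; _≟_)
  import Data.Fin.Properties as FinP
  open import Data.Fin.Subset using (Subset)
  open import Data.Bool using (true; false; if_then_else_; _∧_)
  open import Data.Vec using (lookup)
  open import Data.Product using (_×_; proj₁; proj₂)
  open import Relation.Nullary using (yes; no)
  open import Relation.Nullary.Decidable using (⌊_⌋)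
  open import Relation.Binary.PropositionalEquality
  open import Data.Empty using (⊥-elim)

  ⌊≟⌋-refl : ∀ {k} (a : Fin k) → ⌊ a ≟ a ⌋ ≡ true
  ⌊≟⌋-refl a with a ≟ a
  ... | yes _  = refl
  ... | no a≢a = ⊥-elim (a≢a refl)

  ⌊≟⌋-distinct : ∀ {k} {a b : Fin k} → a ≢ b → ⌊ a ≟ b ⌋ ≡ false
  ⌊≟⌋-distinct {a = a} {b} a≢b with a ≟ b
  ... | yes a≡b = ⊥-elim (a≢b a≡b)
  ... | no _    = refl

  ⌊≟⌋-sym : ∀ {k} (a b : Fin k) → ⌊ a ≟ b ⌋ ≡ ⌊ b ≟ a ⌋
  ⌊≟⌋-sym a b with a ≟ b
  ... | yes refl = sym (⌊≟⌋-refl a)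
  ... | no a≢b   = sym (⌊≟⌋-distinct (≢-sym a≢b))

  module Triplication (n : ℕ) (adj : SimpleAdj n) (S : Subset n) where

    G : EdgeCount (3 ℕ.* n)
    G = 𝒯 n adj S

    copy : Fin 3 → Fin n → Fin (3 ℕ.* n)
    copy = combine

    entry : Fin 3 → Fin n → Fin 3 → Fin n → ℕ
    entry a v b w = if ⌊ a ≟ b ⌋ then (if adj v w then 1 else 0)
                                  else (if ⌊ v ≟ w ⌋ ∧ lookup S v then 1 else 0)

    G-copy : ∀ a v b w → G (copy a v) (copy b w) ≡ entry a v b w
    G-copy a v b w = cong₂ (λ (x y : Fin 3 × Fin n) → entry (proj₁ x) (proj₂ x) (proj₁ y) (proj₂ y))
                           (FinP.remQuot-combine {3} {n} a v) (FinP.remQuot-combine {3} {n} b w)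

    vertex : Fin (3 ℕ.* n) → Fin n
    vertex i = proj₂ (remQuot {3} n i)

    vertex-copy : ∀ a v → vertex (copy a v) ≡ v
    vertex-copy a v = cong proj₂ (FinP.remQuot-combine {3} {n} a v)

    by-copies : ∀ {P : Fin (3 ℕ.* n) → Set} → (∀ a v → P (copy a v)) → ∀ i → P i
    by-copies {P} P-copy i =
      subst P (FinP.combine-remQuot {3} n i) (P-copy (proj₁ (remQuot {3} n i)) (proj₂ (remQuot {3} n i)))

    G-within : ∀ a v w → G (copy a v) (copy a w) ≡ (if adj v w then 1 else 0)
    G-within a v w = trans (G-copy a v a w) (cong (λ b → if b then (if adj v w then 1 else 0) else _) (⌊≟⌋-refl a))

    G-between : ∀ {a b} → a ≢ b → ∀ v w → G (copy a v) (copy b w) ≡ (if ⌊ v ≟ w ⌋ ∧ lookup S v then 1 else 0)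
    G-between {a} {b} a≢b v w =
      trans (G-copy a v b w) (cong (λ c → if c then _ else (if ⌊ v ≟ w ⌋ ∧ lookup S v then 1 else 0)) (⌊≟⌋-distinct a≢b))

    G-tree-edge : ∀ a {v w} → adj v w ≡ true → 1 ℕ.≤ G (copy a v) (copy a w)
    G-tree-edge a {v} {w} vw rewrite G-within a v w | vw = s≤s z≤n

    G-triangle-edge : ∀ {a b} → a ≢ b → ∀ {v} → lookup S v ≡ true → 1 ℕ.≤ G (copy a v) (copy b v)
    G-triangle-edge a≢b {v} v∈S rewrite G-between a≢b v v | ⌊≟⌋-refl v | v∈S = s≤s z≤n

    G-symmetric : IsSymmetric adj → ∀ i j → G i j ≡ G j i
    G-symmetric adj-sym = by-copies λ a v → by-copies λ b w →
      trans (G-copy a v b w) (trans (entry-symmetric a v b w) (sym (G-copy b w a v)))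
      where
      entry-symmetric : ∀ a v b w → entry a v b w ≡ entry b w a v
      entry-symmetric a v b w rewrite ⌊≟⌋-sym a b | adj-sym v w with ⌊ b ≟ a ⌋ | v ≟ w
      ... | true  | _        = refl
      ... | false | yes refl rewrite ⌊≟⌋-refl v = refl
      ... | false | no v≢w   rewrite ⌊≟⌋-distinct (≢-sym v≢w) = refl

    G-loopless : IsLoopless adj → ∀ i → G i i ≡ 0
    G-loopless adj-loopless = by-copies λ a v →
      trans (G-within a v v) (cong (λ b → if b then 1 else 0) (adj-loopless v))

module UpperBound where

  open import Defs
  open FiniteSums
  open Divisors
  open Trees
  open TriplicatedGraph
  open import Data.Nat as ℕ using (ℕ; zero; suc; s≤s; z≤n)
  open import Data.Integer using (ℤ; +_; _-_; _*_; _≤_; 0ℤ)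
  import Data.Integer.Properties as ℤP
  open import Data.Fin using (Fin; _≟_)
  open import Data.Fin.Subset using (Subset)
  open import Data.Vec using (lookup)
  open import Data.Bool using (if_then_else_)
  open import Data.Product using (_,_)
  open import Relation.Nullary using (yes; no)
  open import Relation.Binary.PropositionalEquality
  open import Data.Integer.Tactic.RingSolver using (solve-∀)

  -- Potentials pulled back from T have the same outflow in 𝒯(T) as in T, since
  -- the ends of a triangle edge carry the same value.  Hence the fibres of the two
  -- ends of a tree edge are equivalent, and by connectivity all fibres are.
  module Fibres (n : ℕ) (adj : SimpleAdj n) (S : Subset n) (adj-sym : IsSymmetric adj) (adj-loopless : IsLoopless adj) where

    open Triplication n adj S

    fibre : Fin n → Divisor (3 ℕ.* n)
    fibre p i = point p (vertex i)

    fibre-effective : ∀ p → Effective (fibre p)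
    fibre-effective p i = point-effective p (vertex i)

    fibre-deg : ∀ p → deg (fibre p) ≡ + 3
    fibre-deg p = trans (∑-combine {3} {n} (fibre p))
                        (∑-cong (λ a → trans (∑-cong (λ v → cong (point p) (vertex-copy a v))) (point-deg p)))

    outflow-lift : ∀ (g : Fin n → ℤ) a z → outflow G (λ i → g (vertex i)) (copy a z) ≡ outflow (treeEdges adj) g z
    outflow-lift g a z = begin
      outflow G (λ i → g (vertex i)) (copy a z)
        ≡⟨ ∑-combine {3} {n} _ ⟩
      ∑ (λ b → ∑ (λ w → + G (copy a z) (copy b w) * (g (vertex (copy a z)) - g (vertex (copy b w)))))
        ≡⟨ ∑-cong (λ b → ∑-cong (λ w → cong₂ (λ u v → + G (copy a z) (copy b w) * (g u - g v)) (vertex-copy a z) (vertex-copy b w))) ⟩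
      ∑ towards
        ≡⟨ ∑-concentrated towards a (λ b b≢a → ∑-zeros (across (≢-sym b≢a))) ⟩
      towards a
        ≡⟨ ∑-cong (λ w → cong (λ k → + k * (g z - g w)) (G-within a z w)) ⟩
      outflow (treeEdges adj) g z ∎
      where
      open ≡-Reasoning
      towards : Fin 3 → ℤ
      towards b = ∑ (λ w → + G (copy a z) (copy b w) * (g z - g w))
      no-difference : ∀ k u → k * (u - u) ≡ 0ℤ
      no-difference = solve-∀
      across : ∀ {b} → a ≢ b → ∀ w → + G (copy a z) (copy b w) * (g z - g w) ≡ 0ℤ
      across a≢b w rewrite G-between a≢b z w with z ≟ w
      ... | yes refl = no-difference (+ (if lookup S z then 1 else 0)) (g z)
      ... | no _     = refl

    fibre-edge : IsAcyclic adj → ∀ {x y} → Edge adj x y → LinEquiv G (fibre x) (fibre y)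
    fibre-edge acyclic {x} {y} xy =
      potential⇒LinEquiv G (G-loopless adj-loopless) {fibre x} {fibre y} (λ i → potential (vertex i))
        (by-copies {P = λ i → fibre x i - fibre y i ≡ outflow G (λ j → potential (vertex j)) i} λ a z → begin
          point x (vertex (copy a z)) - point y (vertex (copy a z)) ≡⟨ cong (λ v → point x v - point y v) (vertex-copy a z) ⟩
          point x z - point y z                                     ≡⟨ side-outflow z ⟨
          outflow (treeEdges adj) potential z                       ≡⟨ outflow-lift potential a z ⟨
          outflow G (λ j → potential (vertex j)) (copy a z)         ∎)
      where open SidePotential n adj adj-sym adj-loopless acyclic x y xy
            open ≡-Reasoning

    fibre-walk : IsAcyclic adj → ∀ {p p'} → Walk adj p p' → LinEquiv G (fibre p) (fibre p')
    fibre-walk acyclic {p} here = LinEquiv-equal G {fibre p} {fibre p} (λ _ → refl)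
    fibre-walk acyclic {p} {p'} (step {v = v} xy rest) =
      LinEquiv-trans G {fibre p} {fibre v} {fibre p'} (fibre-edge acyclic xy) (fibre-walk acyclic rest)

    point≤fibre : ∀ q i → point q i ≤ fibre (vertex q) i
    point≤fibre q i with i ≟ q
    ... | yes refl = ℤP.≤-reflexive (sym (point-at (vertex i)))
    ... | no _     = fibre-effective (vertex q) i

    -- Upper bound: a fibre has rank ≥ 1.  A chip q removed from the fibre of p is
    -- compensated by moving to the fibre of the vertex under q, which contains q.
    fibre-rank : IsConnected adj → IsAcyclic adj → ∀ p → RankAtLeast G (fibre p) 1
    fibre-rank connected acyclic p zero z≤n F effF deg≡0 =
      fibre p , fibre-effective p , LinEquiv-equal G {fibre p} {λ i → fibre p i - F i} unchanged
      where unchanged : ∀ i → fibre p i ≡ fibre p i - F i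
            unchanged i = sym (trans (cong (_-_ (fibre p i)) (degree-zero F effF deg≡0 i)) (ℤP.+-identityʳ (fibre p i)))
    fibre-rank connected acyclic p (suc zero) (s≤s z≤n) F effF deg≡1 with degree-one F effF deg≡1
    ... | q , F≡q =
      (λ i → fibre (vertex q) i - F i) ,
      (λ i → ℤP.i≤j⇒0≤j-i (ℤP.≤-trans (ℤP.≤-reflexive (F≡q i)) (point≤fibre q i))) ,
      LinEquiv-shift G {fibre (vertex q)} {fibre p} F (fibre-walk acyclic (connected (vertex q) p))

module LowerBound where

  open import Defs
  open FiniteSums
  open Divisors
  open LevelSets
  open TriplicatedGraph
  open import Data.Nat as ℕ using (ℕ; zero; suc; s≤s; z≤n)
  open import Data.Integer using (ℤ; +_; _+_; _-_; _*_; -_; _≤_; _<_; 0ℤ; +≤+; _≤?_)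
  import Data.Integer.Properties as ℤP
  open import Data.Fin using (Fin; zero; suc; _≟_)
  open import Data.Fin.Subset using (Subset)
  open import Data.Bool using (true; false)
  open import Data.Vec using (lookup)
  open import Data.Product using (Σ; ∃; _×_; _,_; proj₁; proj₂)
  open import Relation.Nullary using (¬_; yes; no)
  open import Relation.Binary using (tri<; tri≈; tri>)
  open import Relation.Binary.PropositionalEquality
  open import Data.Empty using (⊥-elim)
  open import Data.Integer.Tactic.RingSolver using (solve-∀)

  third-copy : ∀ (a b : Fin 3) → a ≢ b → Σ (Fin 3) (λ c → a ≢ c × c ≢ b)
  third-copy zero             zero             a≢b = ⊥-elim (a≢b refl)
  third-copy zero             (suc zero)       _   = suc (suc zero) , (λ ()) , (λ ())
  third-copy zero             (suc (suc zero)) _   = suc zero , (λ ()) , (λ ())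
  third-copy (suc zero)       zero             _   = suc (suc zero) , (λ ()) , (λ ())
  third-copy (suc zero)       (suc zero)       a≢b = ⊥-elim (a≢b refl)
  third-copy (suc zero)       (suc (suc zero)) _   = zero , (λ ()) , (λ ())
  third-copy (suc (suc zero)) zero             _   = suc zero , (λ ()) , (λ ())
  third-copy (suc (suc zero)) (suc zero)       _   = zero , (λ ()) , (λ ())
  third-copy (suc (suc zero)) (suc (suc zero)) a≢b = ⊥-elim (a≢b refl)

  -- A potential witnessing F - D = Δf on 𝒯(T) with deg D ≤ 2 takes the same
  -- value on the three copies of each vertex of S (provided S has two vertices
  -- joined in T).  Otherwise, cutting at the lower value, the triangle at x gives
  -- two crossing edges and the triangle at y or a path of T gives a third, while
  -- the cut is at most deg D ≤ 2.  Consequently no flow passes between copies, and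
  -- the total outflow of every copy vanishes.
  module FlatPotential (n : ℕ) (adj : SimpleAdj n) (S : Subset n)
    (adj-sym : IsSymmetric adj) (adj-loopless : IsLoopless adj)
    (D F f : Divisor (3 ℕ.* n)) (effD : Effective D) (effF : Effective F)
    (F-D=flow : ∀ i → F i - D i ≡ outflow (𝒯 n adj S) f i) (deg≤2 : deg D ≤ + 2) where

    open Triplication n adj S
    open LevelSetCut G (G-symmetric adj-sym) D F f effD effF F-D=flow

    block : ℤ → Fin 3 → Fin 3 → ℤ
    block t a b = ∑ (λ v → ∑ (λ w → crossing t (copy a v) (copy b w)))

    row : ℤ → Fin 3 → ℤ
    row t a = ∑ (λ b → block t a b)

    cut-by-blocks : ∀ t → cut t ≡ ∑ (row t)
    cut-by-blocks t =
      trans (∑-combine {3} {n} (λ i → ∑ (crossing t i)))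
            (∑-cong (λ a → trans (∑-cong (λ v → ∑-combine {3} {n} (crossing t (copy a v))))
                                 (∑-swap (λ v b → ∑ (λ w → crossing t (copy a v) (copy b w))))))

    block-nonneg : ∀ t a b → 0ℤ ≤ block t a b
    block-nonneg t a b = ∑-nonneg (λ v → ∑-nonneg (λ w → crossing-nonneg t (copy a v) (copy b w)))

    crossing≤block : ∀ t a b v w → crossing t (copy a v) (copy b w) ≤ block t a b
    crossing≤block t a b v w =
      ℤP.≤-trans (term≤∑ (λ w → crossing-nonneg t (copy a v) (copy b w)) w)
                 (term≤∑ (λ v → ∑-nonneg (λ w → crossing-nonneg t (copy a v) (copy b w))) v)

    two-crossings≤block : ∀ t a b {v v'} → v ≢ v' →
      crossing t (copy a v) (copy b v) + crossing t (copy a v') (copy b v') ≤ block t a b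
    two-crossings≤block t a b {v} {v'} v≢v' =
      ℤP.≤-trans (ℤP.+-mono-≤ (term≤∑ (λ w → crossing-nonneg t (copy a v) (copy b w)) v)
                              (term≤∑ (λ w → crossing-nonneg t (copy a v') (copy b w)) v'))
                 (two-terms≤∑ (λ v → ∑-nonneg (λ w → crossing-nonneg t (copy a v) (copy b w))) v≢v')

    blocks≤cut : ∀ t {a b c} → a ≢ b → a ≢ c → c ≢ b →
      block t a b + block t a a + block t b b + (block t a c + block t c b) ≤ cut t
    blocks≤cut t {a} {b} {c} a≢b a≢c c≢b = begin
      block t a b + block t a a + block t b b + (block t a c + block t c b)
        ≡⟨ regroup (block t a b) (block t a a) (block t b b) (block t a c) (block t c b) ⟩
      (block t a b + block t a c + block t a a) + block t c b + block t b b
        ≤⟨ ℤP.+-mono-≤ (ℤP.+-mono-≤ (three-terms≤∑ (block-nonneg t a) (≢-sym c≢b) (≢-sym a≢b) (≢-sym a≢c))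
                                    (term≤∑ (block-nonneg t c) b))
                       (term≤∑ (block-nonneg t b) b) ⟩
      row t a + row t c + row t b
        ≤⟨ three-terms≤∑ (λ a → ∑-nonneg (block-nonneg t a)) a≢c a≢b c≢b ⟩
      ∑ (row t)
        ≡⟨ cut-by-blocks t ⟨
      cut t ∎
      where
      open ℤP.≤-Reasoning
      regroup : ∀ ab aa bb ac cb → ab + aa + bb + (ac + cb) ≡ (ab + ac + aa) + cb + bb
      regroup = solve-∀

    walk-crosses : ∀ t a {u w} → Walk adj u w → f (copy a u) ≤ t → ¬ (f (copy a w) ≤ t) → + 1 ≤ block t a a
    walk-crosses t a here          u≤t w≰t = ⊥-elim (w≰t u≤t)
    walk-crosses t a {u} (step {v = v} uv rest) u≤t w≰t with f (copy a v) ≤? t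
    ... | yes v≤t = walk-crosses t a rest v≤t w≰t
    ... | no v≰t  = ℤP.≤-trans (crossing-edge t (copy a u) (copy a v) u≤t v≰t (G-tree-edge a uv))
                               (crossing≤block t a a u v)

    triangle-crosses : ∀ t {a b} → a ≢ b → ∀ {x} → lookup S x ≡ true →
      f (copy a x) ≤ t → ¬ (f (copy b x) ≤ t) → + 1 ≤ crossing t (copy a x) (copy b x)
    triangle-crosses t a≢b x∈S ax≤t bx≰t = crossing-edge t _ _ ax≤t bx≰t (G-triangle-edge a≢b x∈S)

    module Jump {x y : Fin n} (x≢y : x ≢ y) (x∈S : lookup S x ≡ true) (y∈S : lookup S y ≡ true)
      (x⇝y : Walk adj x y) (y⇝x : Walk adj y x) {a b c : Fin 3} (a≢c : a ≢ c) (c≢b : c ≢ b)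
      (bx≰ax : ¬ (f (copy b x) ≤ f (copy a x))) where

      t : ℤ
      t = f (copy a x)

      a≢b : a ≢ b
      a≢b a≡b = bx≰ax (ℤP.≤-reflexive (cong (λ d → f (copy d x)) (sym a≡b)))

      ab≥1 : + 1 ≤ block t a b
      ab≥1 = ℤP.≤-trans (triangle-crosses t a≢b x∈S ℤP.≤-refl bx≰ax) (crossing≤block t a b x x)

      -- the triangle at x crosses the level once more via the third copy c
      via-third : + 1 ≤ block t a c + block t c b
      via-third with f (copy c x) ≤? t
      ... | no cx≰t  = ℤP.≤-trans (ℤP.≤-trans (triangle-crosses t a≢c x∈S ℤP.≤-refl cx≰t) (crossing≤block t a c x x))
                                  (≤-+-nonnegʳ (block-nonneg t c b))
      ... | yes cx≤t = ℤP.≤-trans (ℤP.≤-trans (triangle-crosses t c≢b x∈S cx≤t bx≰ax) (crossing≤block t c b x x))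
                                  (≤-+-nonnegˡ (block-nonneg t a c))

      -- that edge, plus one of: a path in T_a, the triangle at y, a path in T_b
      direct : + 2 ≤ block t a b + block t a a + block t b b
      direct with f (copy a y) ≤? t
      ... | no ay≰t = ℤP.+-mono-≤ (ℤP.+-mono-≤ ab≥1 (walk-crosses t a x⇝y ℤP.≤-refl ay≰t)) (block-nonneg t b b)
      ... | yes ay≤t with f (copy b y) ≤? t
      ...   | no by≰t  = ℤP.+-mono-≤ (ℤP.+-mono-≤ ab≥2 (block-nonneg t a a)) (block-nonneg t b b)
        where ab≥2 : + 2 ≤ block t a b
              ab≥2 = ℤP.≤-trans (ℤP.+-mono-≤ (triangle-crosses t a≢b x∈S ℤP.≤-refl bx≰ax) (triangle-crosses t a≢b y∈S ay≤t by≰t))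
                                (two-crossings≤block t a b x≢y)
      ...   | yes by≤t = ℤP.+-mono-≤ (ℤP.+-mono-≤ ab≥1 (block-nonneg t a a)) (walk-crosses t b y⇝x by≤t bx≰ax)

      three≤cut : + 3 ≤ cut t
      three≤cut = ℤP.≤-trans (ℤP.+-mono-≤ direct via-third) (blocks≤cut t a≢b a≢c c≢b)

    -- a difference between the copies of x forces a cut ≥ 3, beyond deg D ≤ 2
    no-jump : ∀ {x y} → x ≢ y → lookup S x ≡ true → lookup S y ≡ true → Walk adj x y → Walk adj y x →
              ∀ {a b} → a ≢ b → ¬ (f (copy a x) < f (copy b x))
    no-jump x≢y x∈S y∈S x⇝y y⇝x {a} {b} a≢b ax<bx with third-copy a b a≢b
    ... | c , a≢c , c≢b = three≰two (ℤP.≤-trans (Jump.three≤cut x≢y x∈S y∈S x⇝y y⇝x a≢c c≢b (ℤP.<⇒≱ ax<bx))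
                                                 (ℤP.≤-trans (cut≤deg _) deg≤2))
      where three≰two : ¬ (+ 3 ≤ + 2)
            three≰two (+≤+ (s≤s (s≤s ())))

    flat-at : ∀ {x y} → x ≢ y → lookup S x ≡ true → lookup S y ≡ true → Walk adj x y → Walk adj y x →
              ∀ a b → f (copy a x) ≡ f (copy b x)
    flat-at {x} x≢y x∈S y∈S x⇝y y⇝x a b with a ≟ b
    ... | yes refl = refl
    ... | no a≢b with ℤP.<-cmp (f (copy a x)) (f (copy b x))
    ...   | tri< ax<bx _ _ = ⊥-elim (no-jump x≢y x∈S y∈S x⇝y y⇝x a≢b ax<bx)
    ...   | tri≈ _ ax≡bx _ = ax≡bx
    ...   | tri> _ _ bx<ax = ⊥-elim (no-jump x≢y x∈S y∈S x⇝y y⇝x (≢-sym a≢b) bx<ax)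

    module Flat (connected : IsConnected adj) {u₀ v₀ : Fin n} (u₀≢v₀ : u₀ ≢ v₀)
      (u₀∈S : lookup S u₀ ≡ true) (v₀∈S : lookup S v₀ ≡ true) where

      flat : ∀ x → lookup S x ≡ true → ∀ a b → f (copy a x) ≡ f (copy b x)
      flat x x∈S with x ≟ u₀
      ... | yes refl = flat-at u₀≢v₀ x∈S v₀∈S (connected x v₀) (connected v₀ x)
      ... | no x≢u₀  = flat-at x≢u₀ x∈S u₀∈S (connected x u₀) (connected u₀ x)

      no-flow-between : ∀ {b a} → b ≢ a → ∀ v w → + G (copy b v) (copy a w) * (f (copy b v) - f (copy a w)) ≡ 0ℤ
      no-flow-between {b} {a} b≢a v w rewrite G-between b≢a v w with v ≟ w
      ... | no _ = refl
      ... | yes refl with lookup S v in v∈S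
      ...   | false = refl
      ...   | true  rewrite flat v v∈S b a = trans (ℤP.*-identityˡ _) (ℤP.+-inverseʳ (f (copy a v)))

      transfer : Fin 3 → Fin 3 → ℤ
      transfer b a = ∑ (λ v → ∑ (λ w → + G (copy b v) (copy a w) * (f (copy b v) - f (copy a w))))

      transfer-vanishes : ∀ b a → transfer b a ≡ 0ℤ
      transfer-vanishes b a with b ≟ a
      ... | yes refl = ∑-antisymmetric (λ v w → + G (copy b v) (copy b w)) (λ v w → cong +_ (G-symmetric adj-sym (copy b v) (copy b w))) (λ v → f (copy b v))
      ... | no b≢a   = ∑-zeros (λ v → ∑-zeros (no-flow-between b≢a v))

      copy-balance : ∀ b → ∑ (λ v → F (copy b v) - D (copy b v)) ≡ 0ℤ
      copy-balance b = begin
        ∑ (λ v → F (copy b v) - D (copy b v))                  ≡⟨ ∑-cong (λ v → trans (F-D=flow (copy b v)) (∑-combine {3} {n} _)) ⟩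
        ∑ (λ v → ∑ (λ a → ∑ (λ w → flow v a w)))               ≡⟨ ∑-swap (λ v a → ∑ (λ w → flow v a w)) ⟩
        ∑ (transfer b)                                         ≡⟨ ∑-zeros (transfer-vanishes b) ⟩
        0ℤ                                                     ∎
        where open ≡-Reasoning
              flow : Fin n → Fin 3 → Fin n → ℤ
              flow v a w = + G (copy b v) (copy a w) * (f (copy b v) - f (copy a w))

  nonpositive-among-three : ∀ (g : Fin 3 → ℤ) → ∑ g ≤ + 2 → Σ (Fin 3) (λ b → g b ≤ 0ℤ)
  nonpositive-among-three g ∑g≤2 with g zero ≤? 0ℤ | g (suc zero) ≤? 0ℤ | g (suc (suc zero)) ≤? 0ℤ
  ... | yes g₀≤0 | _        | _        = zero , g₀≤0
  ... | no _     | yes g₁≤0 | _        = suc zero , g₁≤0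
  ... | no _     | no _     | yes g₂≤0 = suc (suc zero) , g₂≤0
  ... | no g₀≰0  | no g₁≰0  | no g₂≰0  = ⊥-elim (three≰two (begin
    + 3                                                      ≤⟨ ℤP.+-mono-≤ (one≤ g₀≰0) (ℤP.+-mono-≤ (one≤ g₁≰0) (ℤP.+-mono-≤ (one≤ g₂≰0) ℤP.≤-refl)) ⟩
    g zero + (g (suc zero) + (g (suc (suc zero)) + 0ℤ))      ≤⟨ ∑g≤2 ⟩
    + 2                                                      ∎))
    where
    open ℤP.≤-Reasoning
    one≤ : ∀ {z} → ¬ (z ≤ 0ℤ) → + 1 ≤ z
    one≤ z≰0 = ℤP.i<j⇒suc[i]≤j (ℤP.≰⇒> z≰0)
    three≰two : ¬ (+ 3 ≤ + 2)
    three≰two (+≤+ (s≤s (s≤s ())))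

  -- Lower bound: every effective divisor of rank ≥ 1 on 𝒯(T) has degree ≥ 3.
  -- If deg D ≤ 2, some copy T_b carries no chip of D.  Put a chip q on T_b; rank ≥ 1
  -- gives E ≥ 0 with F = E + q linearly equivalent to D, i.e. F - D is the outflow of
  -- a potential.  That potential is flat on the triangles, so the outflow of T_b
  -- vanishes: F and D have the same number of chips on T_b, yet F has at least one.
  gonality≥3 : ∀ n (adj : SimpleAdj n) → IsTree adj → (S : Subset n) → ∀ {u₀ v₀} → u₀ ≢ v₀ →
    lookup S u₀ ≡ true → lookup S v₀ ≡ true →
    ∀ (D : Divisor (3 ℕ.* n)) → Effective D → RankAtLeast (𝒯 n adj S) D 1 → + 3 ≤ deg D
  gonality≥3 n adj (adj-sym , adj-loopless , connected , _) S {u₀} u₀≢v₀ u₀∈S v₀∈S D effD rank≥1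
    with + 3 ≤? deg D
  ... | yes 3≤deg = 3≤deg
  ... | no 3≰deg  = ⊥-elim (one≰zero (begin
    + 1                                                      ≤⟨ F-chip ⟩
    ∑ (λ v → F (copy b v))                                   ≤⟨ ≤-+-nonnegʳ (ℤP.neg-mono-≤ no-D-chips) ⟩
    ∑ (λ v → F (copy b v)) - ∑ (λ v → D (copy b v))          ≡⟨ ∑-- (λ v → F (copy b v)) (λ v → D (copy b v)) ⟨
    ∑ (λ v → F (copy b v) - D (copy b v))                    ≡⟨ Flat.copy-balance connected u₀≢v₀ u₀∈S v₀∈S b ⟩
    0ℤ                                                       ∎))
    where
    open ℤP.≤-Reasoning
    open Triplication n adj S
    deg≤2 : deg D ≤ + 2
    deg≤2 = ℤP.i<j⇒i≤pred[j] (ℤP.≰⇒> 3≰deg)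
    chip-free : Σ (Fin 3) (λ b → ∑ (λ v → D (copy b v)) ≤ 0ℤ)
    chip-free = nonpositive-among-three (λ a → ∑ (λ v → D (copy a v))) (ℤP.≤-trans (ℤP.≤-reflexive (sym (∑-combine {3} {n} D))) deg≤2)
    b : Fin 3
    b = proj₁ chip-free
    no-D-chips : ∑ (λ v → D (copy b v)) ≤ 0ℤ
    no-D-chips = proj₂ chip-free
    q : Fin (3 ℕ.* n)
    q = copy b u₀
    E-witness : ∃ λ E → Effective E × LinEquiv G E (λ i → D i - point q i)
    E-witness = rank≥1 1 (s≤s z≤n) (point q) (point-effective q) (point-deg q)
    E : Divisor (3 ℕ.* n)
    E = proj₁ E-witness
    effE : Effective E
    effE = proj₁ (proj₂ E-witness)
    F : Divisor (3 ℕ.* n)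
    F i = E i + point q i
    effF : Effective F
    effF i = ℤP.+-mono-≤ (effE i) (point-effective q i)
    potential : Σ (Divisor (3 ℕ.* n)) (λ f → ∀ i → E i - (D i - point q i) ≡ outflow G f i)
    potential = LinEquiv⇒potential G (G-loopless adj-loopless) {E} {λ i → D i - point q i} (proj₂ (proj₂ E-witness))
    F-D=flow : ∀ i → F i - D i ≡ outflow G (proj₁ potential) i
    F-D=flow i = trans (regroup (E i) (point q i) (D i)) (proj₂ potential i)
      where regroup : ∀ x p d → x + p - d ≡ x - (d - p)
            regroup = solve-∀
    open FlatPotential n adj S adj-sym adj-loopless D F (proj₁ potential) effD effF F-D=flow deg≤2
    F-chip : + 1 ≤ ∑ (λ v → F (copy b v))
    F-chip = ℤP.≤-trans (ℤP.≤-trans (ℤP.≤-reflexive (sym (point-at q))) (≤-+-nonnegˡ (effE q)))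
                        (term≤∑ (λ v → effF (copy b v)) u₀)
    one≰zero : ¬ (+ 1 ≤ 0ℤ)
    one≰zero (+≤+ ())

open import Defs
open UpperBound using (module Fibres)
open LowerBound using (gonality≥3)
open import Data.Nat using (ℕ; _≤_)
open import Data.Fin using (Fin)
open import Data.Fin.Subset using (Subset; _∈_)
open import Data.Product using (Σ; ∃; _×_; _,_)
open import Relation.Binary.PropositionalEquality using (_≢_)
import Data.Vec.Properties as VecP

proposition5p1 : (n : ℕ) → (adj : SimpleAdj n) → IsTree adj → 2 ≤ n →
    (S : Subset n) → (∃ λ (u : Fin n) → ∃ λ (v : Fin n) → u ≢ v × u ∈ S × v ∈ S) →
    IsGonality (𝒯 n adj S) 3
proposition5p1 n adj tree@(adj-sym , adj-loopless , connected , acyclic) _ S (u , v , u≢v , u∈S , v∈S) =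
  (fibre u , fibre-effective u , fibre-deg u , fibre-rank connected acyclic u) ,
  (λ D effD rank≥1 → gonality≥3 n adj tree S u≢v (VecP.[]=⇒lookup u∈S) (VecP.[]=⇒lookup v∈S) D effD rank≥1)
  where open Fibres n adj S adj-sym adj-loopless
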